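{- Let $\mathcal{H}$ be a $3$-partite $3$-graph with a matchable FR-partition $(\mathcal{F},\mathcal{R},W)$. Let $a,b,c\in V(\mathcal{H})$ lie in three different vertex classes, and let $S\subseteq W$ be a set of superfluous vertices containing at most one vertex from each vertex class. Then $\nu(\mathcal{H}-(\{a,b,c\}\cup S))=\nu(\mathcal{H})$ in each of the following cases: (1) $a\in V(\mathcal{F})$, $b\in W$, and $c$ is arbitrary; (2) $a\in R$ for some $R\in\mathcal{R}$, $b\notin R$, and $c\notin V(\mathcal{R})$; (3) $a\in W$ is essential for some $R\in\mathcal{R}$, $b$ is not essential for $R$ in $\mathcal{H}-S$, and $c\notin V(\mathcal{R})$; (4) $a\in W$ is not essential in $\mathcal{H}-S$, $b\notin V(\mathcal{R})$, and $c$ is arbitrary.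
   Context: Hypergraphs have finite vertex sets and multisets of edges. A $3$-partite $3$-graph has vertex classes $V_1,V_2,V_3$ with each edge meeting each class in exactly one vertex. $\nu$ is the matching number; $\mathcal{H}|_U$ is the hypergraph of edges contained in $U$; $\mathcal{H}-U$ deletes $U$ and all edges meeting $U$. The truncated Fano plane is the $3$-graph on $\{a,b,c,x,y,z\}$ with edges $abc,ayz,xbz,xyc$; a truncated multi-Fano plane is obtained by adding edges parallel to existing ones. An FR-partition is a triple $(\mathcal{F},\mathcal{R},W)$ with (1) $\mathcal{F}\cup\mathcal{R}\cup\{W\}$ a partition of $V(\mathcal{H})$; (2) $\mathcal{H}|_F$ isomorphic to a truncated multi-Fano plane for each $F\in\mathcal{F}$; (3) each $R\in\mathcal{R}$ a $3$-set with one vertex per class; (4) $|\mathcal{F}\cup\mathcal{R}|=\nu(\mathcal{H})$. $V(\mathcal{F})=\bigcup\mathcal{F}$, $V(\mathcal{R})=\bigcup\mathcal{R}$. $B_i$ is the bipartite graph with classes $\mathcal{R}$ and $W\cap V_i$, $R\sim w$ iff some edge contains $w$ and two vertices of $R$; the partition is matchable if each $B_i$ has a matching saturating $\mathcal{R}$. In a bipartite graph with classes $\mathcal{R}$ and $W\cap V_i$, a set $C\subseteq W\cap V_i$ is essential if $C=N(U)$ for some $U\subseteq\mathcal{R}$ with $|U|=|C|$; when a matching saturating $\mathcal{R}$ exists there is a unique maximal essential set $C_i$. A vertex $v\in W\cap V_i$ is superfluous if $v\notin C_i$ (computed in $B_i$); $v$ is essential if some $R\in\mathcal{R}$ has $v$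 as its only neighbor in $B_i$, and then $v$ is essential for that $R$. "Essential in $\mathcal{H}-S$" refers to the same notions computed for $\mathcal{H}-S$ with the FR-partition $(\mathcal{F},\mathcal{R},W\setminus S)$ (which is again a matchable FR-partition). -}

module Defs where

open import Data.Nat using (ℕ; zero; suc; _+_; _⊔_)
open import Data.Fin using (Fin; zero; suc)
open import Data.Fin.Properties using (_≟_; all?)
open import Data.Fin.Subset using (Subset; _∈_; _∉_; _⊆_; _─_; ∣_∣)
open import Data.Fin.Subset.Properties using (_∈?_)
open import Data.List using (List; []; _∷_; map; _++_; filter; length; foldr)
open import Data.List.Membership.Propositional using () renaming (_∈_ to _∈ˡ_)
open import Data.List.Relation.Unary.AllPairs using (AllPairs; allPairs?)
open import Data.List.Relation.Unary.All using (All)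
open import Data.Product using (Σ; ∃; ∃-syntax; _×_; _,_)
open import Data.Sum using (_⊎_)
open import Relation.Nullary using (¬_; Dec; ¬?)
open import Relation.Binary.PropositionalEquality using (_≡_; _≢_)
open import Function.Bundles using (_⇔_)
open import Function.Definitions using (Injective)

-- An edge of a 3-partite 3-graph is stored as the function
-- i ↦ (its unique vertex in class V_i); the vertex classes are given by
-- a colouring  cls : Fin n → Fin 3  (V_i = {v ∈ V | cls v ≡ i}).
-- The edge multiset is a list (parallel edges allowed).

Edge : ℕ → Set
Edge n = Fin 3 → Fin n

record Hypergraph (n : ℕ) : Set where
  constructor hg
  field
    V : Subset n
    E : List (Edge n)
open Hypergraph public

_∈ₑ_ : ∀ {n} → Fin n → Edge n → Set
v ∈ₑ e = ∃[ i ] e i ≡ v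

ThreePartite : ∀ {n} → (Fin n → Fin 3) → Hypergraph n → Set
ThreePartite cls H = All (λ e → ∀ i → (e i ∈ V H) × (cls (e i) ≡ i)) (E H)

Avoids? : ∀ {n} (U : Subset n) (e : Edge n) → Dec (∀ i → e i ∉ U)
Avoids? U e = all? (λ i → ¬? (e i ∈? U))

_－_ : ∀ {n} → Hypergraph n → Subset n → Hypergraph n
H － U = hg (V H ─ U) (filter (Avoids? U) (E H))

Disjointₑ : ∀ {n} → Edge n → Edge n → Set
Disjointₑ e f = ∀ i j → e i ≢ f j

Disjointₑ? : ∀ {n} (e f : Edge n) → Dec (Disjointₑ e f)
Disjointₑ? e f = all? (λ i → all? (λ j → ¬? (e i ≟ f j)))

sublists : ∀ {A : Set} → List A → List (List A)
sublists []       = [] ∷ []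
sublists (x ∷ xs) = map (x ∷_) (sublists xs) ++ sublists xs

ν : ∀ {n} → Hypergraph n → ℕ
ν H = foldr _⊔_ 0 (map length (filter (allPairs? Disjointₑ?) (sublists (E H))))

-- Truncated multi-Fano plane.
-- Labels a,b,c,x,y,z are 0,1,2,3,4,5 of Fin 6; edges abc, ayz, xbz, xyc.

data FanoEdge : Fin 6 → Fin 6 → Fin 6 → Set where
  abc : FanoEdge zero (suc zero) (suc (suc zero))
  ayz : FanoEdge zero (suc (suc (suc (suc zero)))) (suc (suc (suc (suc (suc zero)))))
  xbz : FanoEdge (suc (suc (suc zero))) (suc zero) (suc (suc (suc (suc (suc zero)))))
  xyc : FanoEdge (suc (suc (suc zero))) (suc (suc (suc (suc zero)))) (suc (suc zero))

EdgeOn : ∀ {n} → Edge n → Fin n → Fin n → Fin n → Set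
EdgeOn e p q r = ∀ v → (v ∈ₑ e) ⇔ (v ≡ p ⊎ v ≡ q ⊎ v ≡ r)

-- H|_F is isomorphic to a truncated multi-Fano plane: a bijection ℓ from
-- the six labels onto F such that every edge of H inside F is (a parallel
-- copy of) a Fano edge, and every Fano edge occurs at least once.
TruncMultiFano : ∀ {n} → Hypergraph n → Subset n → Set
TruncMultiFano {n} H F =
  Σ (Fin 6 → Fin n) λ ℓ →
    Injective _≡_ _≡_ ℓ
  × (∀ v → v ∈ F ⇔ (∃[ t ] ℓ t ≡ v))
  × (∀ e → e ∈ˡ E H → (∀ i → e i ∈ F) →
       ∃[ p ] ∃[ q ] ∃[ r ] FanoEdge p q r × EdgeOn e (ℓ p) (ℓ q) (ℓ r))
  × (∀ p q r → FanoEdge p q r → ∃[ e ] e ∈ˡ E H × EdgeOn e (ℓ p) (ℓ q) (ℓ r))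

record FRData (n : ℕ) : Set where
  constructor frdata
  field
    k : ℕ
    𝓕 : Fin k → Subset n
    m : ℕ
    𝓡 : Fin m → Edge n
    W : Subset n
open FRData public

InVF : ∀ {n} → FRData n → Fin n → Set
InVF P v = ∃[ j ] v ∈ 𝓕 P j

InVR : ∀ {n} → FRData n → Fin n → Set
InVR P v = ∃[ r ] v ∈ₑ 𝓡 P r

IsPartition : ∀ {n} → Hypergraph n → FRData n → Set
IsPartition H P =
    (∀ v → v ∈ V H ⇔ (InVF P v ⊎ InVR P v ⊎ v ∈ W P))
  × (∀ j j' v → v ∈ 𝓕 P j → v ∈ 𝓕 P j' → j ≡ j')
  × (∀ r r' i i' → 𝓡 P r i ≡ 𝓡 P r' i' → r ≡ r')
  × (∀ v → InVF P v → ¬ InVR P v)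
  × (∀ v → InVF P v → v ∉ W P)
  × (∀ v → InVR P v → v ∉ W P)

IsFRPartition : ∀ {n} → (Fin n → Fin 3) → Hypergraph n → FRData n → Set
IsFRPartition cls H P =
    IsPartition H P
  × (∀ j → TruncMultiFano H (𝓕 P j))
  × (∀ r i → cls (𝓡 P r i) ≡ i)
  × (k P + m P ≡ ν H)

-- adjacency in B_i:  R ∼ w  iff  w ∈ W ∩ V_i and some edge contains w
-- and two (distinct) vertices of R
Adj : ∀ {n} → (Fin n → Fin 3) → Hypergraph n → FRData n →
      Fin 3 → Edge n → Fin n → Set
Adj cls H P i R w =
  w ∈ W P × cls w ≡ i ×
  (∃[ e ] e ∈ˡ E H × w ∈ₑ e ×
     ∃[ j ] ∃[ j' ] j ≢ j' × R j ∈ₑ e × R j' ∈ₑ e)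

Matchable : ∀ {n} → (Fin n → Fin 3) → Hypergraph n → FRData n → Set
Matchable {n} cls H P =
  ∀ i → Σ (Fin (m P) → Fin n) λ φ →
    Injective _≡_ _≡_ φ × (∀ r → Adj cls H P i (𝓡 P r) (φ r))

EssentialSet : ∀ {n} → (Fin n → Fin 3) → Hypergraph n → FRData n →
               Fin 3 → Subset n → Set
EssentialSet cls H P i C =
  ∃[ U ] (∀ w → w ∈ C ⇔ (∃[ r ] r ∈ U × Adj cls H P i (𝓡 P r) w))
       × ∣ U ∣ ≡ ∣ C ∣

MaximalEssentialSet : ∀ {n} → (Fin n → Fin 3) → Hypergraph n → FRData n →
                      Fin 3 → Subset n → Set
MaximalEssentialSet cls H P i C =
  EssentialSet cls H P i C ×
  (∀ C' → EssentialSet cls H P i C' → C ⊆ C' → C' ⊆ C)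

Superfluous : ∀ {n} → (Fin n → Fin 3) → Hypergraph n → FRData n → Fin n → Set
Superfluous cls H P v =
  v ∈ W P × (∀ C → MaximalEssentialSet cls H P (cls v) C → v ∉ C)

EssentialFor : ∀ {n} → (Fin n → Fin 3) → Hypergraph n → FRData n →
               Edge n → Fin n → Set
EssentialFor cls H P R v =
  Adj cls H P (cls v) R v × (∀ w → Adj cls H P (cls v) R w → w ≡ v)

EssentialVertex : ∀ {n} → (Fin n → Fin 3) → Hypergraph n → FRData n → Fin n → Set
EssentialVertex cls H P v = ∃[ r ] EssentialFor cls H P (𝓡 P r) v

removeW : ∀ {n} → FRData n → Subset n → FRData n
removeW P S = frdata (k P) (𝓕 P) (m P) (𝓡 P) (W P ─ S)

module Submission where

-- Deleting X = {a, b, c} ∪ S cannot increase ν, so it suffices to find |𝓕| + |𝓡| = ν(H) disjoint edges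
-- avoiding X. A truncated Fano plane has an edge missing any two vertices of different classes, and in every
-- case one of a, b, c lies outside V(𝓕); so each block of 𝓕 contributes an edge avoiding X. Each R ∈ 𝓡
-- contributes an edge through two of its vertices and its partner in a saturating matching of some B_i;
-- injective partners make these edges disjoint. Saturating matchings can avoid S: if one cannot be rerouted
-- around s along alternating paths, the rows reachable from s's row span an essential set containing s,
-- which contradicts superfluity. In each case, a, b and c are then dodged by matching complementary parts
-- of 𝓡 in two different graphs B_i, replacing a partner by a second neighbour where a or b is inessential.

open import Defs
open import Data.Fin using (Fin)
open import Data.Fin.Subset using (Subset; _∈_; _∪_; ⁅_⁆)
open import Data.Product using (∃-syntax; _×_)
open import Data.Sum using (_⊎_)
open import Relation.Nullary using (¬_)
open import Relation.Binary.PropositionalEquality using (_≡_; _≢_)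

open import Data.Nat as ℕ using (ℕ; zero; suc; _+_; _⊔_; _≤_)
import Data.Nat.Properties as ℕ
open import Data.Fin using (zero; suc; punchIn; #_; splitAt; join)
open import Data.Fin.Properties using (_≟_; any?; all?; ¬∀⟶∃¬; punchInᵢ≢i; punchIn-injective; join-splitAt)
open import Data.Fin.Subset using (_∉_; _⊆_; _⊂_; _⊃_; _─_; _-_; ∣_∣; ⊤; ⊥; Nonempty)
open import Data.Fin.Subset.Properties
  using (_∈?_; _⊆?_; _⊂?_; anySubset?; x∈p∪q⁻; x∈p∪q⁺; x∈⁅y⁆⇒x≡y; x∈⁅x⁆; x∈p∧x≢y⇒x∈p-y;
         x∈p∧x∉q⇒x∈p─q; x∈p⇒p-x⊂p; drop-there; x∉⁅y⁆⇒x≢y; nonempty?; Empty-unique; ∣⊥∣≡0; ∉⊥; ∈⊤; p─⊥≡p)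
open import Data.Fin.Subset.Induction using (Acc; acc; ⊂-wellFounded; ⊃-wellFounded)
open import Data.Vec as Vec using (_∷_; tabulate)
open import Data.Vec.Properties using ([]=⇒lookup; lookup⇒[]=; lookup∘tabulate)
open import Data.List using (List; []; _∷_; map; filter; length; foldr)
open import Data.List.Membership.Propositional using (find; lose) renaming (_∈_ to _∈ˡ_)
open import Data.List.Membership.Propositional.Properties
  using (∈-map⁺; ∈-map⁻; ∈-filter⁺; ∈-filter⁻; ∈-++⁺ˡ; ∈-++⁺ʳ; ∈-++⁻)
open import Data.List.Relation.Unary.Any as Any using (here; there)
open import Data.List.Relation.Unary.All as All using (All; []; _∷_)
open import Data.List.Relation.Unary.AllPairs using (AllPairs; []; _∷_; allPairs?)
open import Data.Product using (Σ; ∃; _,_; proj₁; proj₂)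
import Data.Product as Product
open import Data.Sum using (inj₁; inj₂; [_,_])
open import Data.Bool using (true; false)
open import Function using (_∘_; id)
open import Function.Bundles using (_⇔_; mk⇔; Equivalence)
open import Function.Definitions using (Injective)
open import Relation.Nullary using (Dec; yes; no; does; contradiction)
open import Relation.Nullary.Decidable using (_×-dec_; _⊎-dec_; _→-dec_; ¬?; map′; toWitness; dec-true)
open import Relation.Unary using (Decidable)
open import Relation.Binary.PropositionalEquality
  using (refl; sym; trans; cong; cong-app; subst; _≗_; module ≡-Reasoning)

private
  variable
    n N : ℕ

_⇔?_ : ∀ {A B : Set} → Dec A → Dec B → Dec (A ⇔ B)
A? ⇔? B? = map′ (λ (f , g) → mk⇔ f g) (λ A⇔B → Equivalence.to A⇔B , Equivalence.from A⇔B)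
               ((A? →-dec B?) ×-dec (B? →-dec A?))

∃∈? : ∀ {A : Set} {Q : A → Set} → Decidable Q → (xs : List A) → Dec (∃[ x ] x ∈ˡ xs × Q x)
∃∈? Q? xs = map′ find (λ (_ , x∈ , q) → lose x∈ q) (Any.any? Q? xs)

¬→⇒×¬ : ∀ {A B : Set} → Dec A → ¬ (A → B) → A × ¬ B
¬→⇒×¬ (yes a) ¬A→B = a , λ b → ¬A→B (λ _ → b)
¬→⇒×¬ (no ¬a) ¬A→B = contradiction (λ a → contradiction a ¬a) ¬A→B

-- Proved by evaluation; opaque, so that use sites do not unfold the decision procedure.
opaque
  fin3-exhausted : ∀ {i j k : Fin 3} → i ≢ j → i ≢ k → j ≢ k → ∀ t → t ≡ i ⊎ t ≡ j ⊎ t ≡ k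
  fin3-exhausted {i} {j} {k} = toWitness {a? = all? λ i → all? λ j → all? λ k → decide i j k} _ i j k
    where
    decide : (i j k : Fin 3) → Dec (i ≢ j → i ≢ k → j ≢ k → ∀ t → t ≡ i ⊎ t ≡ j ⊎ t ≡ k)
    decide i j k = ¬? (i ≟ j) →-dec ¬? (i ≟ k) →-dec ¬? (j ≟ k) →-dec all? λ t → t ≟ i ⊎-dec t ≟ j ⊎-dec t ≟ k

x∈p─q⁻ : ∀ {x : Fin n} (p q : Subset n) → x ∈ p ─ q → x ∈ p × x ∉ q
x∈p─q⁻ (true ∷ p) (false ∷ q) Vec.here = Vec.here , λ ()
x∈p─q⁻ {x = zero} (true ∷ p) (true ∷ q) ()
x∈p─q⁻ {x = zero} (false ∷ p) (true ∷ q) ()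
x∈p─q⁻ {x = zero} (false ∷ p) (false ∷ q) ()
x∈p─q⁻ (_ ∷ p) (_ ∷ q) (Vec.there x∈) = Product.map Vec.there (λ x∉q → x∉q ∘ drop-there) (x∈p─q⁻ p q x∈)

x∈p-y⁻ : ∀ {x y : Fin n} (p : Subset n) → x ∈ p - y → x ∈ p × x ≢ y
x∈p-y⁻ p x∈ = Product.map id x∉⁅y⁆⇒x≢y (x∈p─q⁻ p ⁅ _ ⁆ x∈)

∣p∣≡1+∣p-x∣ : ∀ {x : Fin n} (p : Subset n) → x ∈ p → ∣ p ∣ ≡ suc ∣ p - x ∣
∣p∣≡1+∣p-x∣ (true ∷ p) Vec.here = cong (suc ∘ ∣_∣) (sym (p─⊥≡p p))
∣p∣≡1+∣p-x∣ (true ∷ p) (Vec.there x∈p) = cong suc (∣p∣≡1+∣p-x∣ p x∈p)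
∣p∣≡1+∣p-x∣ (false ∷ p) (Vec.there x∈p) = ∣p∣≡1+∣p-x∣ p x∈p

subset : ∀ {P : Fin n → Set} → Decidable P → Subset n
subset P? = tabulate (does ∘ P?)

∈-subset⁺ : ∀ {P : Fin n → Set} (P? : Decidable P) {x} → P x → x ∈ subset P?
∈-subset⁺ P? {x} px = lookup⇒[]= x _ (trans (lookup∘tabulate (does ∘ P?) x) (dec-true (P? x) px))

∈-subset⁻ : ∀ {P : Fin n → Set} (P? : Decidable P) {x} → x ∈ subset P? → P x
∈-subset⁻ P? {x} x∈ with P? x | trans (sym (lookup∘tabulate (does ∘ P?) x)) ([]=⇒lookup x∈)
... | yes px | _ = px
... | no _ | ()

⊈⇒∃∉ : ∀ {p q : Subset n} → ¬ p ⊆ q → ∃[ x ] x ∈ p × x ∉ q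
⊈⇒∃∉ {n} {p} {q} p⊈q =
  let x , ¬[x∈p⇒x∈q] = ¬∀⟶∃¬ n (λ x → x ∈ p → x ∈ q) (λ x → x ∈? p →-dec x ∈? q) (λ h → p⊈q (h _))
  in x , ¬→⇒×¬ (x ∈? p) ¬[x∈p⇒x∈q]

InjectiveOn : ∀ {A : Set} → Subset N → (Fin N → A) → Set
InjectiveOn U φ = ∀ {r r′} → r ∈ U → r′ ∈ U → φ r ≡ φ r′ → r ≡ r′

injective-onto⇒∣≡∣ : ∀ {N n} (φ : Fin N → Fin n) (U : Subset N) (C : Subset n) → InjectiveOn U φ →
                     (∀ {w} → w ∈ C → ∃[ r ] r ∈ U × φ r ≡ w) → (∀ {r} → r ∈ U → φ r ∈ C) → ∣ U ∣ ≡ ∣ C ∣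
injective-onto⇒∣≡∣ {N} {n} φ U = go U (⊂-wellFounded U)
  where
  go : ∀ U → Acc _⊂_ U → ∀ C → InjectiveOn U φ →
       (∀ {w} → w ∈ C → ∃[ r ] r ∈ U × φ r ≡ w) → (∀ {r} → r ∈ U → φ r ∈ C) → ∣ U ∣ ≡ ∣ C ∣
  go U (acc rs) C inj onto into with nonempty? U
  ... | no U-empty = trans (cong ∣_∣ (Empty-unique U-empty))
                       (trans (∣⊥∣≡0 N) (sym (trans (cong ∣_∣ (Empty-unique C-empty)) (∣⊥∣≡0 n))))
    where
    C-empty : ¬ Nonempty C
    C-empty (w , w∈C) = U-empty (Product.map id proj₁ (onto w∈C))
  ... | yes (x , x∈U) = begin
      ∣ U ∣            ≡⟨ ∣p∣≡1+∣p-x∣ U x∈U ⟩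
      suc ∣ U - x ∣    ≡⟨ cong suc (go (U - x) (rs (x∈p⇒p-x⊂p x∈U)) (C - φ x) inj′ onto′ into′) ⟩
      suc ∣ C - φ x ∣  ≡⟨ sym (∣p∣≡1+∣p-x∣ C (into x∈U)) ⟩
      ∣ C ∣            ∎
    where
    open ≡-Reasoning
    inj′ : InjectiveOn (U - x) φ
    inj′ r∈ r′∈ = inj (proj₁ (x∈p-y⁻ U r∈)) (proj₁ (x∈p-y⁻ U r′∈))
    onto′ : ∀ {w} → w ∈ C - φ x → ∃[ r ] r ∈ U - x × φ r ≡ w
    onto′ w∈ with x∈p-y⁻ C w∈
    ... | w∈C , w≢φx with onto w∈C
    ... | r , r∈U , refl = r , x∈p∧x≢y⇒x∈p-y r∈U (λ r≡x → w≢φx (cong φ r≡x)) , refl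
    into′ : ∀ {r} → r ∈ U - x → φ r ∈ C - φ x
    into′ r∈ with x∈p-y⁻ U r∈
    ... | r∈U , r≢x = x∈p∧x≢y⇒x∈p-y (into r∈U) (λ φr≡φx → r≢x (inj r∈U x∈U φr≡φx))

image? : (φ : Fin N → Fin n) (U : Subset N) → Decidable (λ w → ∃[ r ] r ∈ U × φ r ≡ w)
image? φ U w = any? λ r → r ∈? U ×-dec φ r ≟ w

image : (Fin N → Fin n) → Subset N → Subset n
image φ U = subset (image? φ U)

∈-image⁺ : ∀ {φ : Fin N → Fin n} {U r} → r ∈ U → φ r ∈ image φ U
∈-image⁺ {φ = φ} {U} r∈U = ∈-subset⁺ (image? φ U) (_ , r∈U , refl)

∈-image⁻ : ∀ {φ : Fin N → Fin n} {U w} → w ∈ image φ U → ∃[ r ] r ∈ U × φ r ≡ w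
∈-image⁻ {φ = φ} {U} = ∈-subset⁻ (image? φ U)

∣U∣≡∣image∣ : ∀ {φ : Fin N → Fin n} {U} → InjectiveOn U φ → ∣ U ∣ ≡ ∣ image φ U ∣
∣U∣≡∣image∣ {φ = φ} {U} injective = injective-onto⇒∣≡∣ φ U (image φ U) injective ∈-image⁻ ∈-image⁺

maximal-extension : ∀ {P : Subset n → Set} → (∀ C → Dec (P C)) → ∀ {C} → P C →
                    ∃[ C* ] (P C* × (∀ C′ → P C′ → C* ⊆ C′ → C′ ⊆ C*)) × C ⊆ C*
maximal-extension {n} {P} P? {C} pC = go C (⊃-wellFounded C) pC
  where
  go : ∀ C → Acc _⊃_ C → P C → ∃[ C* ] (P C* × (∀ C′ → P C′ → C* ⊆ C′ → C′ ⊆ C*)) × C ⊆ C*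
  go C (acc rs) pC with anySubset? (λ C′ → P? C′ ×-dec C ⊂? C′)
  ... | yes (C′ , pC′ , C⊂C′) =
    let C* , maximal , C′⊆C* = go C′ (rs C⊂C′) pC′ in C* , maximal , C′⊆C* ∘ proj₁ C⊂C′
  ... | no no-larger = C , (pC , maximal) , id
    where
    maximal : ∀ C′ → P C′ → C ⊆ C′ → C′ ⊆ C
    maximal C′ pC′ C⊆C′ with C′ ⊆? C
    ... | yes C′⊆C = C′⊆C
    ... | no C′⊈C = contradiction (C′ , pC′ , (λ {x} → C⊆C′ {x}) , ⊈⇒∃∉ C′⊈C) no-larger

-- The matching number

≤-foldr-⊔ : ∀ {x} (xs : List ℕ) → x ∈ˡ xs → x ≤ foldr _⊔_ 0 xs
≤-foldr-⊔ (y ∷ ys) (here refl) = ℕ.m≤m⊔n y _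
≤-foldr-⊔ (y ∷ ys) (there x∈) = ℕ.≤-trans (≤-foldr-⊔ ys x∈) (ℕ.m≤n⊔m y _)

foldr-⊔-≤ : ∀ {b} (xs : List ℕ) → (∀ {x} → x ∈ˡ xs → x ≤ b) → foldr _⊔_ 0 xs ≤ b
foldr-⊔-≤ [] _ = ℕ.z≤n
foldr-⊔-≤ (y ∷ ys) ≤b = ℕ.⊔-lub (≤b (here refl)) (foldr-⊔-≤ ys (≤b ∘ there))

sublists-filter : ∀ {A : Set} {P : A → Set} (P? : Decidable P) (xs : List A) {s} →
                  s ∈ˡ sublists (filter P? xs) → s ∈ˡ sublists xs
sublists-filter P? [] s∈ = s∈
sublists-filter P? (x ∷ xs) s∈ with does (P? x)
... | false = ∈-++⁺ʳ (map (x ∷_) (sublists xs)) (sublists-filter P? xs s∈)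
... | true with ∈-++⁻ (map (x ∷_) (sublists (filter P? xs))) s∈
...   | inj₂ s∈′ = ∈-++⁺ʳ (map (x ∷_) (sublists xs)) (sublists-filter P? xs s∈′)
...   | inj₁ x∷s∈ with ∈-map⁻ (x ∷_) x∷s∈
...     | s′ , s′∈ , refl = ∈-++⁺ˡ (∈-map⁺ (x ∷_) (sublists-filter P? xs s′∈))

module _ {n : ℕ} where

  matching≤ν : (H : Hypergraph n) {s : List (Edge n)} → s ∈ˡ sublists (E H) → AllPairs Disjointₑ s → length s ≤ ν H
  matching≤ν H s∈ disjoint = ≤-foldr-⊔ _ (∈-map⁺ length (∈-filter⁺ (allPairs? Disjointₑ?) s∈ disjoint))

  ν-－ : (H : Hypergraph n) (U : Subset n) → ν (H － U) ≤ ν H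
  ν-－ H U = foldr-⊔-≤ _ bounded
    where
    bounded : ∀ {x} → x ∈ˡ map length (filter (allPairs? Disjointₑ?) (sublists (E (H － U)))) → x ≤ ν H
    bounded x∈ with ∈-map⁻ length x∈
    ... | s , s∈ , refl with ∈-filter⁻ (allPairs? Disjointₑ?) s∈
    ...   | s∈′ , disjoint = matching≤ν H (sublists-filter (Avoids? U) (E H) s∈′) disjoint

  _≗?_ : (e f : Edge n) → Dec (e ≗ f)
  e ≗? f = all? (λ i → e i ≟ f i)

  PairwiseDisjoint : ∀ {N} → (Fin N → Edge n) → Set
  PairwiseDisjoint f = ∀ {j j′} → j ≢ j′ → Disjointₑ (f j) (f j′)

  -- Edges are compared pointwise (≗), since ≡ on functions Fin 3 → Fin n is not decidable.
  disjoint-family-sublist : ∀ (xs : List (Edge n)) {N} (f : Fin N → Edge n) → (∀ j → f j ∈ˡ xs) → PairwiseDisjoint f →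
    ∃[ s ] s ∈ˡ sublists xs × AllPairs Disjointₑ s × length s ≡ N × All (λ e → ∃[ j ] e ≗ f j) s
  disjoint-family-sublist [] {zero} f _ _ = [] , here refl , [] , refl , []
  disjoint-family-sublist [] {suc N} f f∈ _ = contradiction (f∈ zero) λ ()
  disjoint-family-sublist (x ∷ xs) f f∈ disjoint with any? (λ j → f j ≗? x)
  ... | no x∉f =
    let s , s∈ , s-disjoint , length-s , s⊆f = disjoint-family-sublist xs f f∈xs disjoint
    in s , ∈-++⁺ʳ (map (x ∷_) (sublists xs)) s∈ , s-disjoint , length-s , s⊆f
    where
    f∈xs : ∀ j → f j ∈ˡ xs
    f∈xs j = Any.tail (λ fj≡x → x∉f (j , cong-app fj≡x)) (f∈ j)
  disjoint-family-sublist (x ∷ xs) {suc N} f f∈ disjoint | yes (j₀ , fj₀≗x) =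
    let s , s∈ , s-disjoint , length-s , s⊆g = disjoint-family-sublist xs g g∈xs (disjoint ∘ punchIn-≢)
    in x ∷ s , ∈-++⁺ˡ (∈-map⁺ (x ∷_) s∈) , All.map x-disjoint s⊆g ∷ s-disjoint , cong suc length-s ,
       (j₀ , λ i → sym (fj₀≗x i)) ∷ All.map (λ (j , e≗) → punchIn j₀ j , e≗) s⊆g
    where
    g : Fin N → Edge n
    g = f ∘ punchIn j₀
    punchIn-≢ : ∀ {j j′} → j ≢ j′ → punchIn j₀ j ≢ punchIn j₀ j′
    punchIn-≢ j≢j′ = j≢j′ ∘ punchIn-injective j₀ _ _
    x-disjoint : ∀ {e} → ∃[ j ] e ≗ g j → Disjointₑ x e
    x-disjoint (j , e≗gj) t t′ xt≡et′ =
      disjoint (punchInᵢ≢i j₀ j ∘ sym) t t′ (trans (fj₀≗x t) (trans xt≡et′ (e≗gj t′)))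
    g∈xs : ∀ j → g j ∈ˡ xs
    g∈xs j = Any.tail (λ gj≡x → x-disjoint (j , λ _ → refl) zero zero (sym (cong-app gj≡x zero))) (f∈ (punchIn j₀ j))

  ≤ν : (H : Hypergraph n) {N : ℕ} (f : Fin N → Edge n) → (∀ j → f j ∈ˡ E H) → PairwiseDisjoint f → N ≤ ν H
  ≤ν H f f∈ disjoint with disjoint-family-sublist (E H) f f∈ disjoint
  ... | s , s∈ , s-disjoint , refl , _ = matching≤ν H s∈ s-disjoint

  ≤ν-⊎ : (H : Hypergraph n) {K M : ℕ} (f : Fin K ⊎ Fin M → Edge n) → (∀ x → f x ∈ˡ E H) →
         (∀ {x y} → x ≢ y → Disjointₑ (f x) (f y)) → K + M ≤ ν H
  ≤ν-⊎ H {K} {M} f f∈ disjoint = ≤ν H (f ∘ splitAt K) (f∈ ∘ splitAt K) λ {j} {j′} j≢j′ → disjoint λ eq → j≢j′ (begin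
    j                  ≡⟨ sym (join-splitAt K M j) ⟩
    join K M (splitAt K j)  ≡⟨ cong (join K M) eq ⟩
    join K M (splitAt K j′) ≡⟨ join-splitAt K M j′ ⟩
    j′                 ∎)
    where open ≡-Reasoning

-- Alternating paths in bipartite graphs

some-or-all : ∀ {P Q : Fin n → Set} → (∀ i → P i ⊎ Q i) → (∃[ i ] P i) ⊎ (∀ i → Q i)
some-or-all {zero} _ = inj₂ λ ()
some-or-all {suc n} f with f zero | some-or-all (f ∘ suc)
... | inj₁ p | _ = inj₁ (zero , p)
... | inj₂ _ | inj₁ (i , p) = inj₁ (suc i , p)
... | inj₂ q | inj₂ qs = inj₂ λ { zero → q ; (suc i) → qs i }

module Alternating {N n : ℕ} (A : Fin N → Fin n → Set) (A? : ∀ r w → Dec (A r w)) where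

  MatchesOutside : (Fin N → Fin n) → Subset N → Subset n → Set
  MatchesOutside φ L F = (∀ {r} → r ∈ L → A r (φ r) × φ r ∉ F) × InjectiveOn L φ

  Closed : (Fin N → Fin n) → Subset N → Subset n → Set
  Closed φ U F = ∀ {r w} → r ∈ U → A r w → w ∉ F → ∃[ r′ ] r′ ∈ U × φ r′ ≡ w

  Rerouted : (Fin N → Fin n) → Subset N → Subset n → Fin N → Set
  Rerouted φ L F r₀ = ∃[ ψ ] MatchesOutside ψ L F × (∀ {r} → r ∈ L → ψ r ≢ φ r₀)

  Blocked : (Fin N → Fin n) → Subset N → Subset n → Fin N → Set
  Blocked φ L F r₀ = ∃[ U ] U ⊆ L × r₀ ∈ U × Closed φ U F

  _[_≔_] : (Fin N → Fin n) → Fin N → Fin n → Fin N → Fin n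
  (ψ [ r₀ ≔ w ]) r with r ≟ r₀
  ... | yes _ = w
  ... | no _ = ψ r

  restrict : ∀ {φ L F r₀} → r₀ ∈ L → MatchesOutside φ L F → MatchesOutside φ (L - r₀) (F ∪ ⁅ φ r₀ ⁆)
  restrict {φ} {L} {F} {r₀} r₀∈L (matched , injective) = matched′ , λ r∈ r′∈ → injective (∈L r∈) (∈L r′∈)
    where
    ∈L : ∀ {r} → r ∈ L - r₀ → r ∈ L
    ∈L = proj₁ ∘ x∈p-y⁻ L
    matched′ : ∀ {r} → r ∈ L - r₀ → A r (φ r) × φ r ∉ F ∪ ⁅ φ r₀ ⁆
    matched′ r∈ with x∈p-y⁻ L r∈
    ... | r∈L , r≢r₀ = proj₁ (matched r∈L) ,
      [ proj₂ (matched r∈L) , (λ φr∈ → r≢r₀ (injective r∈L r₀∈L (x∈⁅y⁆⇒x≡y _ φr∈))) ] ∘ x∈p∪q⁻ F _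

  extend : ∀ {φ L F r₀ ψ w} → MatchesOutside ψ (L - r₀) (F ∪ ⁅ φ r₀ ⁆) → A r₀ w → w ∉ F → w ≢ φ r₀ →
           (∀ {r} → r ∈ L - r₀ → ψ r ≢ w) → Rerouted φ L F r₀
  extend {φ} {L} {F} {r₀} {ψ} {w} (matched , injective) A-r₀w w∉F w≢φr₀ ψ≢w =
    ψ [ r₀ ≔ w ] , (matched′ , injective′) , avoids
    where
    ∈L-r₀ : ∀ {r} → r ∈ L → r ≢ r₀ → r ∈ L - r₀
    ∈L-r₀ = x∈p∧x≢y⇒x∈p-y
    matched′ : ∀ {r} → r ∈ L → A r ((ψ [ r₀ ≔ w ]) r) × (ψ [ r₀ ≔ w ]) r ∉ F
    matched′ {r} r∈L with r ≟ r₀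
    ... | yes refl = A-r₀w , w∉F
    ... | no r≢r₀ = proj₁ (matched (∈L-r₀ r∈L r≢r₀)) , proj₂ (matched (∈L-r₀ r∈L r≢r₀)) ∘ x∈p∪q⁺ ∘ inj₁
    injective′ : InjectiveOn L (ψ [ r₀ ≔ w ])
    injective′ {r} {r′} r∈L r′∈L eq with r ≟ r₀ | r′ ≟ r₀
    ... | yes refl | yes refl = refl
    ... | yes refl | no r′≢r₀ = contradiction (sym eq) (ψ≢w (∈L-r₀ r′∈L r′≢r₀))
    ... | no r≢r₀ | yes refl = contradiction eq (ψ≢w (∈L-r₀ r∈L r≢r₀))
    ... | no r≢r₀ | no r′≢r₀ = injective (∈L-r₀ r∈L r≢r₀) (∈L-r₀ r′∈L r′≢r₀) eq
    avoids : ∀ {r} → r ∈ L → (ψ [ r₀ ≔ w ]) r ≢ φ r₀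
    avoids {r} r∈L with r ≟ r₀
    ... | yes refl = w≢φr₀
    ... | no r≢r₀ = λ ψr≡φr₀ →
      proj₂ (matched (∈L-r₀ r∈L r≢r₀)) (x∈p∪q⁺ (inj₂ (subst (_∈ ⁅ φ r₀ ⁆) (sym ψr≡φr₀) (x∈⁅x⁆ (φ r₀)))))

  Candidate : (Fin N → Fin n) → Subset n → Fin N → Fin n → Set
  Candidate φ F r₀ w = A r₀ w × w ∉ F × w ≢ φ r₀

  Reaches : (Fin N → Fin n) → Subset N → Subset n → Fin N → Fin n → Set
  Reaches φ L F r₀ w = ∃[ U ] U ⊆ L - r₀ × Closed φ U (F ∪ ⁅ φ r₀ ⁆) × (Candidate φ F r₀ w → ∃[ r ] r ∈ U × φ r ≡ w)

  blocked-by-union : ∀ {φ L F r₀} → r₀ ∈ L → (∀ w → Reaches φ L F r₀ w) → Blocked φ L F r₀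
  blocked-by-union {φ} {L} {F} {r₀} r₀∈L reaches = U , U⊆L , ∈-subset⁺ U? (inj₁ refl) , closed
    where
    U? : ∀ r → Dec (r ≡ r₀ ⊎ ∃[ w ] r ∈ proj₁ (reaches w))
    U? r = r ≟ r₀ ⊎-dec any? (λ w → r ∈? proj₁ (reaches w))
    U : Subset N
    U = subset U?
    U⊆L : U ⊆ L
    U⊆L r∈ with ∈-subset⁻ U? r∈
    ... | inj₁ refl = r₀∈L
    ... | inj₂ (w , r∈Uw) = proj₁ (x∈p-y⁻ L (proj₁ (proj₂ (reaches w)) r∈Uw))
    closed : Closed φ U F
    closed {r} {w} r∈U A-rw w∉F with w ≟ φ r₀ | ∈-subset⁻ U? r∈U
    ... | yes refl | _ = r₀ , ∈-subset⁺ U? (inj₁ refl) , refl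
    ... | no w≢φr₀ | inj₁ refl =
      let r′ , r′∈Uw , φr′≡w = proj₂ (proj₂ (proj₂ (reaches w))) (A-rw , w∉F , w≢φr₀)
      in r′ , ∈-subset⁺ U? (inj₂ (w , r′∈Uw)) , φr′≡w
    ... | no w≢φr₀ | inj₂ (w′ , r∈Uw′) =
      let r′ , r′∈Uw′ , φr′≡w = proj₁ (proj₂ (proj₂ (reaches w′))) r∈Uw′ A-rw
                                  ([ w∉F , w≢φr₀ ∘ x∈⁅y⁆⇒x≡y _ ] ∘ x∈p∪q⁻ F _)
      in r′ , ∈-subset⁺ U? (inj₂ (w′ , r′∈Uw′)) , φr′≡w

  -- Either some neighbour w of r₀ is free (or can be freed by recursion on L - r₀), and r₀ moves to w,
  -- or no neighbour can be freed and the rows reached from r₀ form a closed set.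
  reroute-or-block : ∀ {φ L F r₀} → MatchesOutside φ L F → r₀ ∈ L → Rerouted φ L F r₀ ⊎ Blocked φ L F r₀
  reroute-or-block {L = L} = go L (⊂-wellFounded L)
    where
    go : ∀ L → Acc _⊂_ L → ∀ {φ F r₀} → MatchesOutside φ L F → r₀ ∈ L → Rerouted φ L F r₀ ⊎ Blocked φ L F r₀
    go L (acc rs) {φ} {F} {r₀} φ-matches r₀∈L =
      [ inj₁ ∘ proj₂ , inj₂ ∘ blocked-by-union r₀∈L ] (some-or-all step)
      where
      φ-matches′ : MatchesOutside φ (L - r₀) (F ∪ ⁅ φ r₀ ⁆)
      φ-matches′ = restrict r₀∈L φ-matches
      step : ∀ w → Rerouted φ L F r₀ ⊎ Reaches φ L F r₀ w
      step w with A? r₀ w ×-dec ¬? (w ∈? F) ×-dec ¬? (w ≟ φ r₀)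
      ... | no ¬candidate = inj₂ (⊥ , (λ r∈⊥ → contradiction r∈⊥ ∉⊥) , (λ r∈⊥ → contradiction r∈⊥ ∉⊥) ,
                                  λ candidate → contradiction candidate ¬candidate)
      ... | yes (A-r₀w , w∉F , w≢φr₀) with any? (λ r → r ∈? L ×-dec φ r ≟ w)
      ...   | no unmatched = inj₁ (extend {φ = φ} φ-matches′ A-r₀w w∉F w≢φr₀
                                     λ r∈ φr≡w → unmatched (_ , proj₁ (x∈p-y⁻ L r∈) , φr≡w))
      ...   | yes (r₁ , r₁∈L , φr₁≡w)
              with go (L - r₀) (rs (x∈p⇒p-x⊂p r₀∈L)) φ-matches′ (x∈p∧x≢y⇒x∈p-y r₁∈L λ { refl → w≢φr₀ (sym φr₁≡w) })
      ...     | inj₁ (ψ , ψ-matches , ψ≢φr₁) = inj₁ (extend {φ = φ} ψ-matches A-r₀w w∉F w≢φr₀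
                                                    λ r∈ ψr≡w → ψ≢φr₁ r∈ (trans ψr≡w (sym φr₁≡w)))
      ...     | inj₂ (U , U⊆L′ , r₁∈U , closed) = inj₂ (U , U⊆L′ , closed , λ _ → r₁ , r₁∈U , φr₁≡w)

-- Matchings of B_i avoiding superfluous vertices

_∈ₑ?_ : (v : Fin n) (e : Edge n) → Dec (v ∈ₑ e)
v ∈ₑ? e = any? (λ i → e i ≟ v)

module _ {n : ℕ} (cls : Fin n → Fin 3) (H : Hypergraph n) (P : FRData n) where

  Adj-W : ∀ {i R w} → Adj cls H P i R w → w ∈ W P
  Adj-W = proj₁

  Adj-class : ∀ {i R w} → Adj cls H P i R w → cls w ≡ i
  Adj-class = proj₁ ∘ proj₂

  Adj? : ∀ i R w → Dec (Adj cls H P i R w)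
  Adj? i R w = w ∈? W P ×-dec cls w ≟ i ×-dec ∃∈? through-R? (E H)
    where
    through-R? : ∀ e → Dec (w ∈ₑ e × ∃[ j ] ∃[ j′ ] j ≢ j′ × R j ∈ₑ e × R j′ ∈ₑ e)
    through-R? e = w ∈ₑ? e ×-dec any? λ j → any? λ j′ → ¬? (j ≟ j′) ×-dec R j ∈ₑ? e ×-dec R j′ ∈ₑ? e

  EssentialSet? : ∀ i C → Dec (EssentialSet cls H P i C)
  EssentialSet? i C = anySubset? λ U →
    all? (λ w → (w ∈? C) ⇔? any? (λ r → r ∈? U ×-dec Adj? i (𝓡 P r) w)) ×-dec ∣ U ∣ ℕ.≟ ∣ C ∣

  another-neighbour : ∀ {R v} → Adj cls H P (cls v) R v → ¬ EssentialFor cls H P R v →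
                      ∃[ w ] Adj cls H P (cls v) R w × w ≢ v
  another-neighbour {R} {v} adjacent not-essential =
    let w , ¬[adj⇒≡v] = ¬∀⟶∃¬ n _ (λ w → Adj? (cls v) R w →-dec w ≟ v) (not-essential ∘ (adjacent ,_))
    in w , ¬→⇒×¬ (Adj? (cls v) R w) ¬[adj⇒≡v]

  record Saturating (i : Fin 3) (S : Subset n) : Set where
    field
      partner : Fin (m P) → Fin n
      injective : Injective _≡_ _≡_ partner
      adjacent : ∀ r → Adj cls H P i (𝓡 P r) (partner r)
      avoids : ∀ r → partner r ∉ S

    partner∈W : ∀ r → partner r ∈ W P
    partner∈W = Adj-W ∘ adjacent

    partner-class : ∀ r → cls (partner r) ≡ i
    partner-class = Adj-class ∘ adjacent

  module Bᵢ (i : Fin 3) = Alternating (λ r → Adj cls H P i (𝓡 P r)) (λ r → Adj? i (𝓡 P r))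

  essential-image : ∀ {i φ U} → (∀ r → Adj cls H P i (𝓡 P r) (φ r)) → Injective _≡_ _≡_ φ →
                    Bᵢ.Closed i φ U ⊥ → EssentialSet cls H P i (image φ U)
  essential-image {i} {φ} {U} φ-adjacent φ-injective closed =
    U , (λ w → mk⇔ (into-N w) (from-N w)) , ∣U∣≡∣image∣ λ _ _ → φ-injective
    where
    into-N : ∀ w → w ∈ image φ U → ∃[ r ] r ∈ U × Adj cls H P i (𝓡 P r) w
    into-N w w∈ with ∈-image⁻ {φ = φ} w∈
    ... | r , r∈U , refl = r , r∈U , φ-adjacent r
    from-N : ∀ w → (∃[ r ] r ∈ U × Adj cls H P i (𝓡 P r) w) → w ∈ image φ U
    from-N w (r , r∈U , adjacent) =
      let r′ , r′∈U , φr′≡w = closed r∈U adjacent ∉⊥ in subst (_∈ image φ U) φr′≡w (∈-image⁺ r′∈U)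

  -- A matching that cannot be rerouted around s exposes an essential set containing s.
  superfluous-avoidable : Matchable cls H P → ∀ {s} → Superfluous cls H P s →
    Σ (Fin (m P) → Fin n) λ ψ → Injective _≡_ _≡_ ψ × (∀ r → Adj cls H P (cls s) (𝓡 P r) (ψ r) × ψ r ≢ s)
  superfluous-avoidable matchable {s} (_ , outside-maximal) with matchable (cls s)
  ... | φ , φ-injective , φ-adjacent with any? (λ r → φ r ≟ s)
  ...   | no φ≢s = φ , φ-injective , λ r → φ-adjacent r , λ φr≡s → φ≢s (r , φr≡s)
  ...   | yes (r₀ , φr₀≡s)
          with Bᵢ.reroute-or-block (cls s) {φ} {⊤} {⊥} ((λ _ → φ-adjacent _ , ∉⊥) , λ _ _ → φ-injective) ∈⊤
  ...     | inj₁ (ψ , (ψ-matched , ψ-injective) , ψ≢φr₀) =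
    ψ , ψ-injective ∈⊤ ∈⊤ , λ r → proj₁ (ψ-matched ∈⊤) , λ ψr≡s → ψ≢φr₀ ∈⊤ (trans ψr≡s (sym φr₀≡s))
  ...     | inj₂ (U , _ , r₀∈U , closed) =
    let C* , C*-maximal , image⊆C* =
          maximal-extension (EssentialSet? (cls s)) (essential-image φ-adjacent φ-injective closed)
    in contradiction (image⊆C* (subst (_∈ image φ U) φr₀≡s (∈-image⁺ r₀∈U))) (outside-maximal C* C*-maximal)

  saturating-avoiding : Matchable cls H P → ∀ {S} → (∀ v → v ∈ S → Superfluous cls H P v) →
    (∀ u v → u ∈ S → v ∈ S → cls u ≡ cls v → u ≡ v) → ∀ i → Saturating i S
  saturating-avoiding matchable {S} superfluous one-per-class i with any? (λ s → s ∈? S ×-dec cls s ≟ i)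
  ... | no none =
    let φ , φ-injective , φ-adjacent = matchable i
    in record { partner = φ ; injective = φ-injective ; adjacent = φ-adjacent
              ; avoids = λ r φr∈S → none (_ , φr∈S , Adj-class (φ-adjacent r)) }
  ... | yes (s , s∈S , refl) =
    let ψ , ψ-injective , ψ-adjacent = superfluous-avoidable matchable (superfluous s s∈S)
    in record { partner = ψ ; injective = ψ-injective ; adjacent = proj₁ ∘ ψ-adjacent
              ; avoids = λ r ψr∈S →
                  proj₂ (ψ-adjacent r) (one-per-class _ s ψr∈S s∈S (Adj-class (proj₁ (ψ-adjacent r)))) }

-- Truncated Fano planes in 3-partite hypergraphs

module _ {n : ℕ} (cls : Fin n → Fin 3) {H : Hypergraph n} (three-partite : ThreePartite cls H) where

  class-of-position : ∀ {e} → e ∈ˡ E H → ∀ t → cls (e t) ≡ t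
  class-of-position e∈ t = proj₂ (All.lookup three-partite e∈ t)

  position-of-class : ∀ {e v} → e ∈ˡ E H → v ∈ₑ e → e (cls v) ≡ v
  position-of-class {e} e∈ (t , refl) = cong e (class-of-position e∈ t)

triple : ∀ {A : Set} → A → A → A → Fin 3 → A
triple x y z = Vec.lookup (x ∷ y ∷ z ∷ Vec.[])

-- The points a, b, c, x, y, z are 0, …, 5, and opposite points (a x, b y, c z) lie on no common line.
fanoLine : Fin 4 → Edge 6
fanoLine zero = triple (# 0) (# 1) (# 2)
fanoLine (suc zero) = triple (# 0) (# 4) (# 5)
fanoLine (suc (suc zero)) = triple (# 3) (# 1) (# 5)
fanoLine (suc (suc (suc zero))) = triple (# 3) (# 4) (# 2)

fanoLine-isFanoEdge : ∀ k → FanoEdge (fanoLine k zero) (fanoLine k (# 1)) (fanoLine k (# 2))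
fanoLine-isFanoEdge zero = abc
fanoLine-isFanoEdge (suc zero) = ayz
fanoLine-isFanoEdge (suc (suc zero)) = xbz
fanoLine-isFanoEdge (suc (suc (suc zero))) = xyc

opposite : Fin 6 → Fin 6
opposite = Vec.lookup (# 3 ∷ # 4 ∷ # 5 ∷ # 0 ∷ # 1 ∷ # 2 ∷ Vec.[])

opaque
  fanoLine-injective : ∀ k {i j} → fanoLine k i ≡ fanoLine k j → i ≡ j
  fanoLine-injective k {i} {j} =
    toWitness {a? = all? λ k → all? λ i → all? λ j → fanoLine k i ≟ fanoLine k j →-dec i ≟ j} _ k i j

  fano-missing-point : ∀ p → ∃[ k ] ¬ p ∈ₑ fanoLine k
  fano-missing-point = toWitness {a? = all? λ p → any? λ k → ¬? (p ∈ₑ? fanoLine k)} _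

  fano-missing-pair : ∀ p q → q ≢ p → q ≢ opposite p → ∃[ k ] ¬ p ∈ₑ fanoLine k × ¬ q ∈ₑ fanoLine k
  fano-missing-pair = toWitness {a? = all? λ p → all? λ q → ¬? (q ≟ p) →-dec ¬? (q ≟ opposite p) →-dec
                                       any? λ k → ¬? (p ∈ₑ? fanoLine k) ×-dec ¬? (q ∈ₑ? fanoLine k)} _

fin3-remaining : ∀ {i j k t : Fin 3} → i ≢ j → i ≢ k → j ≢ k → t ≢ j → t ≢ k → t ≡ i
fin3-remaining i≢j i≢k j≢k t≢j t≢k with fin3-exhausted i≢j i≢k j≢k _
... | inj₁ t≡i = t≡i
... | inj₂ (inj₁ t≡j) = contradiction t≡j t≢j
... | inj₂ (inj₂ t≡k) = contradiction t≡k t≢k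

module TruncatedFano {n : ℕ} {cls : Fin n → Fin 3} {H : Hypergraph n} (three-partite : ThreePartite cls H)
                     {F : Subset n} (fano : TruncMultiFano H F) where

  ℓ : Fin 6 → Fin n
  ℓ = proj₁ fano

  ℓ-injective : Injective _≡_ _≡_ ℓ
  ℓ-injective = proj₁ (proj₂ fano)

  σ : Fin 6 → Fin 3
  σ = cls ∘ ℓ

  private
    realisation : ∀ k → ∃[ e ] e ∈ˡ E H × EdgeOn e (ℓ (fanoLine k zero)) (ℓ (fanoLine k (# 1))) (ℓ (fanoLine k (# 2)))
    realisation k = proj₂ (proj₂ (proj₂ (proj₂ fano))) _ _ _ (fanoLine-isFanoEdge k)

  block : Fin 4 → Edge n
  block k = proj₁ (realisation k)

  block∈E : ∀ k → block k ∈ˡ E H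
  block∈E k = proj₁ (proj₂ (realisation k))

  block-vertex : ∀ k t → ∃[ i ] block k t ≡ ℓ (fanoLine k i)
  block-vertex k t with Equivalence.to (proj₂ (proj₂ (realisation k)) (block k t)) (t , refl)
  ... | inj₁ eq = zero , eq
  ... | inj₂ (inj₁ eq) = # 1 , eq
  ... | inj₂ (inj₂ eq) = # 2 , eq

  point∈block : ∀ k i → ℓ (fanoLine k i) ∈ₑ block k
  point∈block k i = Equivalence.from (proj₂ (proj₂ (realisation k)) _) (point i)
    where
    point : ∀ i → ℓ (fanoLine k i) ≡ ℓ (fanoLine k zero) ⊎ ℓ (fanoLine k i) ≡ ℓ (fanoLine k (# 1))
                                       ⊎ ℓ (fanoLine k i) ≡ ℓ (fanoLine k (# 2))
    point zero = inj₁ refl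
    point (suc zero) = inj₂ (inj₁ refl)
    point (suc (suc zero)) = inj₂ (inj₂ refl)

  block⊆F : ∀ k t → block k t ∈ F
  block⊆F k t = Equivalence.from (proj₁ (proj₂ (proj₂ fano)) _) (_ , sym (proj₂ (block-vertex k t)))

  σ-distinct : ∀ k {i j} → i ≢ j → σ (fanoLine k i) ≢ σ (fanoLine k j)
  σ-distinct k {i} {j} i≢j σi≡σj = i≢j (fanoLine-injective k (ℓ-injective (begin
    ℓ (fanoLine k i)          ≡⟨ sym (position-of-class cls three-partite (block∈E k) (point∈block k i)) ⟩
    block k (σ (fanoLine k i)) ≡⟨ cong (block k) σi≡σj ⟩
    block k (σ (fanoLine k j)) ≡⟨ position-of-class cls three-partite (block∈E k) (point∈block k j) ⟩
    ℓ (fanoLine k j)          ∎)))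
    where open ≡-Reasoning

  private
    a≢b : σ (# 0) ≢ σ (# 1)
    a≢b = σ-distinct (# 0) {# 0} {# 1} λ ()
    a≢c : σ (# 0) ≢ σ (# 2)
    a≢c = σ-distinct (# 0) {# 0} {# 2} λ ()
    b≢c : σ (# 1) ≢ σ (# 2)
    b≢c = σ-distinct (# 0) {# 1} {# 2} λ ()
    x≡a : σ (# 3) ≡ σ (# 0)
    x≡a = fin3-remaining a≢b a≢c b≢c (σ-distinct (# 2) {# 0} {# 1} λ ()) (σ-distinct (# 3) {# 0} {# 2} λ ())
    y≡b : σ (# 4) ≡ σ (# 1)
    y≡b = fin3-remaining (a≢b ∘ sym) b≢c a≢c (σ-distinct (# 1) {# 1} {# 0} λ ()) (σ-distinct (# 3) {# 1} {# 2} λ ())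
    z≡c : σ (# 5) ≡ σ (# 2)
    z≡c = fin3-remaining (a≢c ∘ sym) (b≢c ∘ sym) a≢b
            (σ-distinct (# 1) {# 2} {# 0} λ ()) (σ-distinct (# 2) {# 2} {# 1} λ ())

  -- x is collinear with b and with c, so it has the class of a; likewise for y and z.
  σ-opposite : ∀ p → σ (opposite p) ≡ σ p
  σ-opposite zero = x≡a
  σ-opposite (suc zero) = y≡b
  σ-opposite (suc (suc zero)) = z≡c
  σ-opposite (suc (suc (suc zero))) = sym x≡a
  σ-opposite (suc (suc (suc (suc zero)))) = sym y≡b
  σ-opposite (suc (suc (suc (suc (suc zero))))) = sym z≡c

  Misses : Fin 4 → Fin n → Set
  Misses k u = ∀ i → ℓ (fanoLine k i) ≢ u

  misses-labelled : ∀ {p} k → ¬ p ∈ₑ fanoLine k → Misses k (ℓ p)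
  misses-labelled _ p∉ i eq = p∉ (i , ℓ-injective eq)

  misses-unlabelled : ∀ {u} k → (∀ p → ℓ p ≢ u) → Misses k u
  misses-unlabelled k unlabelled i = unlabelled (fanoLine k i)

  line-missing : ∀ {u v} → cls u ≢ cls v → ∃[ k ] Misses k u × Misses k v
  line-missing {u} {v} u≁v with any? (λ p → ℓ p ≟ u) | any? (λ q → ℓ q ≟ v)
  ... | yes (p , refl) | yes (q , refl) =
    let k , p∉ , q∉ = fano-missing-pair p q (λ { refl → u≁v refl }) (λ { refl → u≁v (sym (σ-opposite p)) })
    in k , misses-labelled k p∉ , misses-labelled k q∉
  ... | yes (p , refl) | no v-unlabelled =
    let k , p∉ = fano-missing-point p in k , misses-labelled k p∉ , misses-unlabelled k (λ q eq → v-unlabelled (q , eq))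
  ... | no u-unlabelled | yes (q , refl) =
    let k , q∉ = fano-missing-point q in k , misses-unlabelled k (λ p eq → u-unlabelled (p , eq)) , misses-labelled k q∉
  ... | no u-unlabelled | no v-unlabelled =
    zero , misses-unlabelled zero (λ p eq → u-unlabelled (p , eq)) ,
           misses-unlabelled zero (λ q eq → v-unlabelled (q , eq))

  edge-missing : ∀ {u v} → cls u ≢ cls v → ∃[ e ] e ∈ˡ E H × (∀ t → e t ∈ F) × (∀ t → e t ≢ u × e t ≢ v)
  edge-missing u≁v =
    let k , misses-u , misses-v = line-missing u≁v
        off : ∀ {w} → Misses k w → ∀ t → block k t ≢ w
        off misses t = let i , eq = block-vertex k t in misses i ∘ trans (sym eq)
    in block k , block∈E k , block⊆F k , λ t → off misses-u t , off misses-v t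

module FRPartition {n : ℕ} (cls : Fin n → Fin 3) (H : Hypergraph n) (P : FRData n)
                   (three-partite : ThreePartite cls H) (fr : IsFRPartition cls H P) where

  R : Fin (m P) → Edge n
  R = 𝓡 P

  F-disjoint : ∀ {j j′ v} → v ∈ 𝓕 P j → v ∈ 𝓕 P j′ → j ≡ j′
  F-disjoint = proj₁ (proj₂ (proj₁ fr)) _ _ _

  R-disjoint : ∀ {r r′ t t′} → R r t ≡ R r′ t′ → r ≡ r′
  R-disjoint = proj₁ (proj₂ (proj₂ (proj₁ fr))) _ _ _ _

  VF∩VR : ∀ {v} → InVF P v → ¬ InVR P v
  VF∩VR = proj₁ (proj₂ (proj₂ (proj₂ (proj₁ fr)))) _

  VF∩W : ∀ {v} → InVF P v → v ∉ W P
  VF∩W = proj₁ (proj₂ (proj₂ (proj₂ (proj₂ (proj₁ fr))))) _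

  VR∩W : ∀ {v} → InVR P v → v ∉ W P
  VR∩W = proj₂ (proj₂ (proj₂ (proj₂ (proj₂ (proj₁ fr))))) _

  fano-block : ∀ j → TruncMultiFano H (𝓕 P j)
  fano-block = proj₁ (proj₂ fr)

  R-class : ∀ r t → cls (R r t) ≡ t
  R-class = proj₁ (proj₂ (proj₂ fr))

  k+m≡ν : k P + m P ≡ ν H
  k+m≡ν = proj₂ (proj₂ (proj₂ fr))

  ≢-by-class : ∀ {x y i} → cls x ≡ i → i ≢ cls y → x ≢ y
  ≢-by-class refl i≢ refl = i≢ refl

  R≢-by-class : ∀ {r t v} → t ≢ cls v → R r t ≢ v
  R≢-by-class = ≢-by-class (R-class _ _)

  R≢W : ∀ {r t v} → v ∈ W P → R r t ≢ v
  R≢W v∈W refl = VR∩W (_ , _ , refl) v∈W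

  R≢∉VR : ∀ {r t v} → ¬ InVR P v → R r t ≢ v
  R≢∉VR v∉VR refl = v∉VR (_ , _ , refl)

  W≢VR : ∀ {w v} → w ∈ W P → InVR P v → w ≢ v
  W≢VR w∈W v∈VR refl = VR∩W v∈VR w∈W

  W≢VF : ∀ {w v} → w ∈ W P → InVF P v → w ≢ v
  W≢VF w∈W v∈VF refl = VF∩W v∈VF w∈W

  adjacent-edge : ∀ {i r w} → Adj cls H P i (R r) w → Edge n
  adjacent-edge adjacent = proj₁ (proj₂ (proj₂ adjacent))

  adjacent-edge∈E : ∀ {i r w} (adjacent : Adj cls H P i (R r) w) → adjacent-edge adjacent ∈ˡ E H
  adjacent-edge∈E adjacent = proj₁ (proj₂ (proj₂ (proj₂ adjacent)))

  adjacent-edge-vertex : ∀ {i r w} (adjacent : Adj cls H P i (R r) w) →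
                         ∀ t → adjacent-edge adjacent t ≡ w ⊎ t ≢ i × adjacent-edge adjacent t ≡ R r t
  adjacent-edge-vertex {r = r} {w} (w∈W , refl , e , e∈ , w∈e , j , j′ , j≢j′ , Rj∈e , Rj′∈e) t =
    vertex (fin3-exhausted i≢j i≢j′ j≢j′ t)
    where
    at-R : ∀ {x} → R r x ∈ₑ e → e x ≡ R r x
    at-R {x} Rx∈e = trans (cong e (sym (R-class r x))) (position-of-class cls three-partite e∈ Rx∈e)
    at-w : e (cls w) ≡ w
    at-w = position-of-class cls three-partite e∈ w∈e
    i≢j : cls w ≢ j
    i≢j refl = R≢W w∈W (trans (sym (at-R Rj∈e)) at-w)
    i≢j′ : cls w ≢ j′
    i≢j′ refl = R≢W w∈W (trans (sym (at-R Rj′∈e)) at-w)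
    vertex : t ≡ cls w ⊎ t ≡ j ⊎ t ≡ j′ → e t ≡ w ⊎ t ≢ cls w × e t ≡ R r t
    vertex (inj₁ refl) = inj₁ at-w
    vertex (inj₂ (inj₁ refl)) = inj₂ (i≢j ∘ sym , at-R Rj∈e)
    vertex (inj₂ (inj₂ refl)) = inj₂ (i≢j′ ∘ sym , at-R Rj′∈e)

  adjacent-within : ∀ {S i r w} → Adj cls (H － S) (removeW P S) i (R r) w → Adj cls H P i (R r) w × w ∉ S
  adjacent-within {S} (w∈W─S , class , e , e∈ , rest) =
    (proj₁ (x∈p─q⁻ (W P) S w∈W─S) , class , e , proj₁ (∈-filter⁻ (Avoids? S) e∈) , rest) , proj₂ (x∈p─q⁻ (W P) S w∈W─S)

  adjacent-without : ∀ {S i r w} → (∀ {v} → v ∈ S → v ∈ W P) → Adj cls H P i (R r) w → w ∉ S →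
                     Adj cls (H － S) (removeW P S) i (R r) w
  adjacent-without {S} {r = r} {w} S⊆W adjacent@(w∈W , class , e , e∈ , rest) w∉S =
    x∈p∧x∉q⇒x∈p─q w∈W w∉S , class , e , ∈-filter⁺ (Avoids? S) e∈ avoids-S , rest
    where
    avoids-S : ∀ t → e t ∉ S
    avoids-S t with adjacent-edge-vertex adjacent t
    ... | inj₁ eq = subst (_∉ S) (sym eq) w∉S
    ... | inj₂ (_ , eq) = subst (_∉ S) (sym eq) (VR∩W (r , t , refl) ∘ S⊆W)

  FanoEdgesAvoiding : Subset n → Set
  FanoEdgesAvoiding X = ∀ j → ∃[ e ] e ∈ˡ E H × (∀ t → e t ∈ 𝓕 P j) × (∀ t → e t ∉ X)

  record Representative (X : Subset n) (r : Fin (m P)) : Set where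
    field
      class : Fin 3
      vertex : Fin n
      adjacent : Adj cls H P class (R r) vertex
      vertex∉X : vertex ∉ X
      others∉X : ∀ t → t ≢ class → R r t ∉ X

    class-of-vertex : cls vertex ≡ class
    class-of-vertex = Adj-class cls H P adjacent

    vertex∈W : vertex ∈ W P
    vertex∈W = Adj-W cls H P adjacent

    edge : Edge n
    edge = adjacent-edge adjacent

    edge-vertex : ∀ t → edge t ≡ vertex ⊎ t ≢ class × edge t ≡ R r t
    edge-vertex = adjacent-edge-vertex adjacent

    edge∉X : ∀ t → edge t ∉ X
    edge∉X t with edge-vertex t
    ... | inj₁ eq = subst (_∉ X) (sym eq) vertex∉X
    ... | inj₂ (t≢class , eq) = subst (_∉ X) (sym eq) (others∉X t t≢class)

  same-class : ∀ {X r r′} (ρ : Representative X r) (ρ′ : Representative X r′) →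
               Representative.vertex ρ ≡ Representative.vertex ρ′ → Representative.class ρ ≡ Representative.class ρ′
  same-class ρ ρ′ eq = trans (sym (class-of-vertex ρ)) (trans (cong cls eq) (class-of-vertex ρ′))
    where open Representative

  Representatives : Subset n → Set
  Representatives X = Σ (∀ r → Representative X r) λ ρ → Injective _≡_ _≡_ (Representative.vertex ∘ ρ)

  ν-preserved : ∀ {X} → FanoEdgesAvoiding X → Representatives X → ν (H － X) ≡ ν H
  ν-preserved {X} fano-edges (ρ , vertex-injective) =
    ℕ.≤-antisym (ν-－ H X) (subst (_≤ ν (H － X)) k+m≡ν (≤ν-⊎ (H － X) family family∈ disjoint))
    where
    open Representative using (adjacent; vertex∈W; edge-vertex; edge∉X)
    fano-edge⊆𝓕 : ∀ j t → proj₁ (fano-edges j) t ∈ 𝓕 P j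
    fano-edge⊆𝓕 j = proj₁ (proj₂ (proj₂ (fano-edges j)))
    family : Fin (k P) ⊎ Fin (m P) → Edge n
    family = [ proj₁ ∘ fano-edges , Representative.edge ∘ ρ ]
    family∈ : ∀ x → family x ∈ˡ E (H － X)
    family∈ (inj₁ j) = let _ , e∈ , _ , e∉X = fano-edges j in ∈-filter⁺ (Avoids? X) e∈ e∉X
    family∈ (inj₂ r) = ∈-filter⁺ (Avoids? X) (adjacent-edge∈E (adjacent (ρ r))) (edge∉X (ρ r))
    fano-rep-disjoint : ∀ j r → Disjointₑ (family (inj₁ j)) (family (inj₂ r))
    fano-rep-disjoint j r t t′ eq with edge-vertex (ρ r) t′
    ... | inj₁ eq′ = VF∩W (j , fano-edge⊆𝓕 j t) (subst (_∈ W P) (sym (trans eq eq′)) (vertex∈W (ρ r)))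
    ... | inj₂ (_ , eq′) = VF∩VR (j , fano-edge⊆𝓕 j t) (r , t′ , sym (trans eq eq′))
    disjoint : ∀ {x y} → x ≢ y → Disjointₑ (family x) (family y)
    disjoint {inj₁ j} {inj₁ j′} j≢j′ t t′ eq =
      j≢j′ (cong inj₁ (F-disjoint (fano-edge⊆𝓕 j t) (subst (_∈ 𝓕 P j′) (sym eq) (fano-edge⊆𝓕 j′ t′))))
    disjoint {inj₁ j} {inj₂ r} _ = fano-rep-disjoint j r
    disjoint {inj₂ r} {inj₁ j} _ t t′ eq = fano-rep-disjoint j r t′ t (sym eq)
    disjoint {inj₂ r} {inj₂ r′} r≢r′ t t′ eq with edge-vertex (ρ r) t | edge-vertex (ρ r′) t′
    ... | inj₁ eq₁ | inj₁ eq₂ = r≢r′ (cong inj₂ (vertex-injective (trans (sym eq₁) (trans eq eq₂))))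
    ... | inj₁ eq₁ | inj₂ (_ , eq₂) = R≢W (vertex∈W (ρ r)) (trans (sym eq₂) (trans (sym eq) eq₁))
    ... | inj₂ (_ , eq₁) | inj₁ eq₂ = R≢W (vertex∈W (ρ r′)) (trans (sym eq₁) (trans eq eq₂))
    ... | inj₂ (_ , eq₁) | inj₂ (_ , eq₂) = r≢r′ (cong inj₂ (R-disjoint (trans (sym eq₁) (trans eq eq₂))))

-- Deleting a, b, c and superfluous vertices

module Deletion {n : ℕ} (cls : Fin n → Fin 3) (H : Hypergraph n) (P : FRData n)
                (three-partite : ThreePartite cls H) (fr : IsFRPartition cls H P) (matchable : Matchable cls H P)
                {a b c : Fin n} (a≁b : cls a ≢ cls b) (b≁c : cls b ≢ cls c) (a≁c : cls a ≢ cls c)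
                {S : Subset n} (superfluous : ∀ v → v ∈ S → Superfluous cls H P v)
                (one-per-class : ∀ u v → u ∈ S → v ∈ S → cls u ≡ cls v → u ≡ v) where

  open FRPartition cls H P three-partite fr

  X : Subset n
  X = ((⁅ a ⁆ ∪ ⁅ b ⁆) ∪ ⁅ c ⁆) ∪ S

  Off : Fin n → Set
  Off v = v ≢ a × v ≢ b × v ≢ c

  ∉X : ∀ {v} → Off v → v ∉ S → v ∉ X
  ∉X (v≢a , v≢b , v≢c) v∉S =
    [ [ [ v≢a ∘ x∈⁅y⁆⇒x≡y a , v≢b ∘ x∈⁅y⁆⇒x≡y b ] ∘ x∈p∪q⁻ _ _ , v≢c ∘ x∈⁅y⁆⇒x≡y c ] ∘ x∈p∪q⁻ _ _ , v∉S ] ∘ x∈p∪q⁻ _ _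

  S⊆W : ∀ {v} → v ∈ S → v ∈ W P
  S⊆W {v} v∈S = proj₁ (superfluous v v∈S)

  R∉S : ∀ {r t} → R r t ∉ S
  R∉S R∈S = R≢W (S⊆W R∈S) refl

  matching : ∀ i → Saturating cls H P i S
  matching = saturating-avoiding cls H P matchable superfluous one-per-class

  InVR? : ∀ v → Dec (InVR P v)
  InVR? v = any? λ r → v ∈ₑ? R r

  fano-edges : ∀ {u v} → cls u ≢ cls v → (∀ {x} → InVF P x → x ≢ u → x ≢ v → Off x) → FanoEdgesAvoiding X
  fano-edges u≁v off j =
    let e , e∈ , e⊆F , e-misses = TruncatedFano.edge-missing three-partite (fano-block j) u≁v
    in e , e∈ , e⊆F , λ t → ∉X (off (j , e⊆F t) (proj₁ (e-misses t)) (proj₂ (e-misses t))) (VF∩W (j , e⊆F t) ∘ S⊆W)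

  representative : ∀ {i r w} → Adj cls H P i (R r) w → w ∉ S → Off w → (∀ t → t ≢ i → Off (R r t)) →
                   Representative X r
  representative {i} {w = w} adjacent w∉S off-w off-R = record
    { class = i ; vertex = w ; adjacent = adjacent
    ; vertex∉X = ∉X off-w w∉S ; others∉X = λ t t≢i → ∉X (off-R t t≢i) R∉S }

  one-class : ∀ {i} (M : Saturating cls H P i S) →
              (∀ r → Off (Saturating.partner M r) × (∀ t → t ≢ i → Off (R r t))) → Representatives X
  one-class M off = (λ r → representative (adjacent r) (avoids r) (proj₁ (off r)) (proj₂ (off r))) , injective
    where open Saturating M

  open Representative using (vertex; class)

  merge : ∀ {D : Fin (m P) → Set} → Decidable D →
          (ρ₁ : ∀ r → D r → Representative X r) (ρ₂ : ∀ r → ¬ D r → Representative X r) →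
          (∀ {r r′} d d′ → vertex (ρ₁ r d) ≡ vertex (ρ₁ r′ d′) → r ≡ r′) →
          (∀ {r r′} d d′ → vertex (ρ₂ r d) ≡ vertex (ρ₂ r′ d′) → r ≡ r′) →
          (∀ {r r′} d d′ → class (ρ₁ r d) ≢ class (ρ₂ r′ d′)) → Representatives X
  merge D? ρ₁ ρ₂ injective₁ injective₂ classes-differ = ρ , injective
    where
    ρ : ∀ r → Representative X r
    ρ r with D? r
    ... | yes d = ρ₁ r d
    ... | no ¬d = ρ₂ r ¬d
    injective : Injective _≡_ _≡_ (vertex ∘ ρ)
    injective {r} {r′} eq with D? r | D? r′
    ... | yes d | yes d′ = injective₁ d d′ eq
    ... | yes d | no ¬d′ = contradiction (same-class (ρ₁ r d) (ρ₂ r′ ¬d′) eq) (classes-differ d ¬d′)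
    ... | no ¬d | yes d′ = contradiction (same-class (ρ₁ r′ d′) (ρ₂ r ¬d) (sym eq)) (classes-differ d′ ¬d)
    ... | no ¬d | no ¬d′ = injective₂ ¬d ¬d′ eq

  merge-at : ∀ {r₀} (ρ₀ : Representative X r₀) (ρ : ∀ r → r ≢ r₀ → Representative X r) →
             (∀ {r r′} d d′ → vertex (ρ r d) ≡ vertex (ρ r′ d′) → r ≡ r′) →
             (∀ {r} d → class ρ₀ ≢ class (ρ r d)) → Representatives X
  merge-at {r₀} ρ₀ ρ injective classes-differ =
    merge (_≟ r₀) (λ { _ refl → ρ₀ }) ρ (λ { refl refl _ → refl }) injective (λ { refl → classes-differ })

  replace-partner : ∀ {v} (M : Saturating cls H P (cls v) S) {r₀} → Saturating.partner M r₀ ≡ v →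
                    ¬ EssentialFor cls (H － S) (removeW P S) (R r₀) v →
                    ∃[ w ] Adj cls H P (cls v) (R r₀) w × w ∉ S × w ≢ v
  replace-partner {v} M {r₀} partner≡v inessential =
    let v-adjacent = subst (Adj cls H P (cls v) (R r₀)) partner≡v (M.adjacent r₀)
        v∉S = subst (_∉ S) partner≡v (M.avoids r₀)
        w , w-adjacent , w≢v =
          another-neighbour cls (H － S) (removeW P S) (adjacent-without S⊆W v-adjacent v∉S) inessential
    in w , proj₁ (adjacent-within w-adjacent) , proj₂ (adjacent-within w-adjacent) , w≢v
    where module M = Saturating M

  module Ma = Saturating (matching (cls a))
  module Mb = Saturating (matching (cls b))

  case₁ : InVF P a → b ∈ W P → ν (H － X) ≡ ν H
  case₁ a∈VF b∈W = ν-preserved fano (representatives (InVR? c))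
    where
    fano : FanoEdgesAvoiding X
    fano = fano-edges a≁c λ x∈VF x≢a x≢c → x≢a , W≢VF b∈W x∈VF ∘ sym , x≢c
    representatives : Dec (InVR P c) → Representatives X
    representatives (yes c∈VR) = one-class (matching (cls c)) λ r →
      (≢-by-class (partner-class r) (a≁c ∘ sym) , ≢-by-class (partner-class r) (b≁c ∘ sym) , W≢VR (partner∈W r) c∈VR) ,
      λ t t≢ → R≢∉VR (VF∩VR a∈VF) , R≢W b∈W , R≢-by-class t≢
      where open Saturating (matching (cls c))
    representatives (no c∉VR) = one-class (matching (cls a)) λ r →
      (W≢VF (Ma.partner∈W r) a∈VF , ≢-by-class (Ma.partner-class r) a≁b , ≢-by-class (Ma.partner-class r) a≁c) ,
      λ t t≢ → R≢-by-class t≢ , R≢W b∈W , R≢∉VR c∉VR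

  case₂ : ∀ {r₀} → a ∈ₑ R r₀ → ¬ b ∈ₑ R r₀ → ¬ InVR P c → ν (H － X) ≡ ν H
  case₂ {r₀} a∈R₀ b∉R₀ c∉VR = ν-preserved fano
    (merge (λ r → b ∈ₑ? R r) via-b via-a (λ _ _ → Mb.injective) (λ _ _ → Ma.injective) (λ _ _ → a≁b ∘ sym))
    where
    fano : FanoEdgesAvoiding X
    fano = fano-edges b≁c λ x∈VF x≢b x≢c → (λ { refl → VF∩VR x∈VF (r₀ , a∈R₀) }) , x≢b , x≢c
    via-b : ∀ r → b ∈ₑ R r → Representative X r
    via-b r b∈R = representative (Mb.adjacent r) (Mb.avoids r)
      (≢-by-class (Mb.partner-class r) (a≁b ∘ sym) , W≢VR (Mb.partner∈W r) (r , b∈R) ,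
       ≢-by-class (Mb.partner-class r) b≁c)
      λ t t≢ → (λ Rrt≡a → b∉R₀ (subst (λ r → b ∈ₑ R r) (R-disjoint (trans Rrt≡a (sym (proj₂ a∈R₀)))) b∈R)) ,
               R≢-by-class t≢ , R≢∉VR c∉VR
    via-a : ∀ r → ¬ b ∈ₑ R r → Representative X r
    via-a r b∉R = representative (Ma.adjacent r) (Ma.avoids r)
      (W≢VR (Ma.partner∈W r) (r₀ , a∈R₀) , ≢-by-class (Ma.partner-class r) a≁b , ≢-by-class (Ma.partner-class r) a≁c)
      λ t t≢ → R≢-by-class t≢ , (λ Rrt≡b → b∉R (t , Rrt≡b)) , R≢∉VR c∉VR

  case₃ : a ∈ W P → ∀ {r₀} → EssentialFor cls H P (R r₀) a → ¬ EssentialFor cls (H － S) (removeW P S) (R r₀) b →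
          ¬ InVR P c → ν (H － X) ≡ ν H
  case₃ a∈W {r₀} a-essential b-inessential c∉VR = ν-preserved fano (representatives (Mb.partner r₀ ≟ b))
    where
    fano : FanoEdgesAvoiding X
    fano = fano-edges b≁c λ x∈VF x≢b x≢c → W≢VF a∈W x∈VF ∘ sym , x≢b , x≢c
    Ma-r₀≡a : Ma.partner r₀ ≡ a
    Ma-r₀≡a = proj₂ a-essential (Ma.partner r₀) (Ma.adjacent r₀)
    via-a : ∀ r → r ≢ r₀ → ¬ b ∈ₑ R r → Representative X r
    via-a r r≢r₀ b∉R = representative (Ma.adjacent r) (Ma.avoids r)
      ((λ eq → r≢r₀ (Ma.injective (trans eq (sym Ma-r₀≡a)))) ,
       ≢-by-class (Ma.partner-class r) a≁b , ≢-by-class (Ma.partner-class r) a≁c)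
      λ t t≢ → R≢W a∈W , (λ Rrt≡b → b∉R (t , Rrt≡b)) , R≢∉VR c∉VR
    representatives : Dec (Mb.partner r₀ ≡ b) → Representatives X
    representatives (no Mb-r₀≢b) =
      merge (λ r → r ≟ r₀ ⊎-dec b ∈ₑ? R r) via-b (λ r ¬d → via-a r (¬d ∘ inj₁) (¬d ∘ inj₂))
            (λ _ _ → Mb.injective) (λ _ _ → Ma.injective) (λ _ _ → a≁b ∘ sym)
      where
      via-b : ∀ r → r ≡ r₀ ⊎ b ∈ₑ R r → Representative X r
      via-b r d = representative (Mb.adjacent r) (Mb.avoids r)
        (≢-by-class (Mb.partner-class r) (a≁b ∘ sym) , Mb-r≢b d , ≢-by-class (Mb.partner-class r) b≁c)
        λ t t≢ → R≢W a∈W , R≢-by-class t≢ , R≢∉VR c∉VR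
        where
        Mb-r≢b : r ≡ r₀ ⊎ b ∈ₑ R r → Mb.partner r ≢ b
        Mb-r≢b (inj₁ refl) = Mb-r₀≢b
        Mb-r≢b (inj₂ b∈R) = W≢VR (Mb.partner∈W r) (r , b∈R)
    representatives (yes Mb-r₀≡b) =
      let w , w-adjacent , w∉S , w≢b = replace-partner (matching (cls b)) Mb-r₀≡b b-inessential
          b∈W = subst (_∈ W P) Mb-r₀≡b (Mb.partner∈W r₀)
          w-class = Adj-class cls H P w-adjacent
      in merge-at (representative w-adjacent w∉S (≢-by-class w-class (a≁b ∘ sym) , w≢b , ≢-by-class w-class b≁c)
                                  λ _ _ → R≢W a∈W , R≢W b∈W , R≢∉VR c∉VR)
                  (λ r r≢r₀ → via-a r r≢r₀ λ b∈R → W≢VR b∈W (r , b∈R) refl) (λ _ _ → Ma.injective) (λ _ → a≁b ∘ sym)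

  case₄ : a ∈ W P → ¬ EssentialVertex cls (H － S) (removeW P S) a → ¬ InVR P b → ν (H － X) ≡ ν H
  case₄ a∈W a-inessential b∉VR = ν-preserved fano (representatives (InVR? c))
    where
    fano : FanoEdgesAvoiding X
    fano = fano-edges b≁c λ x∈VF x≢b x≢c → W≢VF a∈W x∈VF ∘ sym , x≢b , x≢c
    representatives : Dec (InVR P c) → Representatives X
    representatives (yes c∈VR) = one-class (matching (cls c)) λ r →
      (≢-by-class (partner-class r) (a≁c ∘ sym) , ≢-by-class (partner-class r) (b≁c ∘ sym) , W≢VR (partner∈W r) c∈VR) ,
      λ t t≢ → R≢W a∈W , R≢∉VR b∉VR , R≢-by-class t≢
      where open Saturating (matching (cls c))
    representatives (no c∉VR) = two-classes (any? λ r → Ma.partner r ≟ a ×-dec Mb.partner r ≟ b)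
      where
      R-off : ∀ {r i} t → t ≢ i → Off (R r t)
      R-off t _ = R≢W a∈W , R≢∉VR b∉VR , R≢∉VR c∉VR
      two-classes : Dec (∃[ r ] Ma.partner r ≡ a × Mb.partner r ≡ b) → Representatives X
      two-classes (no never-both) = merge (λ r → Ma.partner r ≟ a) via-b via-a
        (λ _ _ → Mb.injective) (λ _ _ → Ma.injective) (λ _ _ → a≁b ∘ sym)
        where
        via-b : ∀ r → Ma.partner r ≡ a → Representative X r
        via-b r Ma-r≡a = representative (Mb.adjacent r) (Mb.avoids r)
          (≢-by-class (Mb.partner-class r) (a≁b ∘ sym) , (λ Mb-r≡b → never-both (r , Ma-r≡a , Mb-r≡b)) ,
           ≢-by-class (Mb.partner-class r) b≁c) R-off
        via-a : ∀ r → Ma.partner r ≢ a → Representative X r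
        via-a r Ma-r≢a = representative (Ma.adjacent r) (Ma.avoids r)
          (Ma-r≢a , ≢-by-class (Ma.partner-class r) a≁b , ≢-by-class (Ma.partner-class r) a≁c) R-off
      two-classes (yes (r₀ , Ma-r₀≡a , Mb-r₀≡b)) =
        let w , w-adjacent , w∉S , w≢a = replace-partner (matching (cls a)) Ma-r₀≡a (a-inessential ∘ (r₀ ,_))
            w-class = Adj-class cls H P w-adjacent
        in merge-at (representative w-adjacent w∉S (w≢a , ≢-by-class w-class a≁b , ≢-by-class w-class a≁c) R-off)
                    via-b (λ _ _ → Mb.injective) (λ _ → a≁b)
        where
        via-b : ∀ r → r ≢ r₀ → Representative X r
        via-b r r≢r₀ = representative (Mb.adjacent r) (Mb.avoids r)
          (≢-by-class (Mb.partner-class r) (a≁b ∘ sym) , (λ eq → r≢r₀ (Mb.injective (trans eq (sym Mb-r₀≡b)))) ,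
           ≢-by-class (Mb.partner-class r) b≁c) R-off

corollary3p6 : ∀ {n} (cls : Fin n → Fin 3) (H : Hypergraph n) (P : FRData n) →
  ThreePartite cls H → IsFRPartition cls H P → Matchable cls H P →
  (a b c : Fin n) → a ∈ V H → b ∈ V H → c ∈ V H →
  cls a ≢ cls b → cls b ≢ cls c → cls a ≢ cls c →
  (S : Subset n) → (∀ v → v ∈ S → Superfluous cls H P v) →
  (∀ u v → u ∈ S → v ∈ S → cls u ≡ cls v → u ≡ v) →
  ((InVF P a × b ∈ W P)
   ⊎ (∃[ r ] (a ∈ₑ 𝓡 P r) × ¬ (b ∈ₑ 𝓡 P r) × ¬ InVR P c)
   ⊎ (a ∈ W P × (∃[ r ] EssentialFor cls H P (𝓡 P r) a
                        × ¬ EssentialFor cls (H － S) (removeW P S) (𝓡 P r) b)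
              × ¬ InVR P c)
   ⊎ (a ∈ W P × ¬ EssentialVertex cls (H － S) (removeW P S) a × ¬ InVR P b)) →
  ν (H － (((⁅ a ⁆ ∪ ⁅ b ⁆) ∪ ⁅ c ⁆) ∪ S)) ≡ ν H
corollary3p6 cls H P three-partite fr matchable a b c _ _ _ a≁b b≁c a≁c S superfluous one-per-class =
  [ (λ (a∈VF , b∈W) → case₁ a∈VF b∈W)
  , [ (λ (_ , a∈R , b∉R , c∉VR) → case₂ a∈R b∉R c∉VR)
    , [ (λ (a∈W , (_ , a-essential , b-inessential) , c∉VR) → case₃ a∈W a-essential b-inessential c∉VR)
      , (λ (a∈W , a-inessential , b∉VR) → case₄ a∈W a-inessential b∉VR) ] ] ]
  where open Deletion cls H P three-partite fr matchable a≁b b≁c a≁c superfluous one-per-class
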